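{- For every integer $d\ge 1$ the Hamming graph $H(d,4)$ is Hadamard diagonalizable, and for all integers $l,d\ge 1$ the Doob graph $D(l,d)$ is Hadamard diagonalizable.
   Context: Graphs are finite and simple. A (real) Hadamard matrix of order $n$ is an $n\times n$ matrix with entries in $\{1,-1\}$ such that $H^TH=nI$. The Laplacian matrix $L$ of a graph $G$ is defined by $L_{uu}=\deg(u)$, $L_{uv}=-1$ if $u\neq v$ are adjacent, and $L_{uv}=0$ otherwise. $G$ is Hadamard diagonalizable if there is a Hadamard matrix $H$ of order $n=|V(G)|$ such that $\frac1n H^TLH$ is diagonal. The Cartesian product $G\square H$ has vertex set $V(G)\times V(H)$, with $(u,x)\sim(v,y)$ iff ($u=v$ and $xy\in E(H)$) or ($x=y$ and $uv\in E(G)$). The Hamming graph $H(d,4)$ is the Cartesian product of $d$ copies of the complete graph $K_4$. The Shrikhande graph is the Cayley graph on $\mathbb{Z}_4^2$ with connection set $\{\pm(0,1),\pm(1,0),\pm(1,1)\}$, i.e., vertices are elements of $\mathbb{Z}_4^2$ and $u\sim v$ iff $u-v$ lies in this set. The Doob graph $D(l,d)$ is the Cartesian product of $l$ copies of the Shrikhande graph and one copy of $H(d,4)$. -}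

module Defs where

open import Data.Bool using (Bool; true; false; if_then_else_; _∧_; _∨_; not)
open import Data.Nat as ℕ using (ℕ; zero; suc; _%_; _≡ᵇ_)
open import Data.Fin as Fin using (Fin; toℕ; remQuot; _≟_)
open import Data.Integer as ℤ using (ℤ; +_; -_)
open import Data.Product using (_×_; _,_; proj₁; proj₂)
open import Data.Sum using (_⊎_)
open import Relation.Nullary.Decidable using (⌊_⌋)
open import Relation.Binary.PropositionalEquality using (_≡_; _≢_; refl; cong; cong₂; sym)
open import Data.Empty using (⊥-elim)
import Relation.Nullary


record Graph : Set where
  field
    order     : ℕ
    adj       : Fin order → Fin order → Bool
    adj-sym   : ∀ u v → adj u v ≡ adj v u
    adj-irr   : ∀ u → adj u u ≡ false

open Graph public

∑ : ∀ {n} → (Fin n → ℤ) → ℤ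
∑ {zero}  f = + 0
∑ {suc n} f = f Fin.zero ℤ.+ ∑ (λ i → f (Fin.suc i))

Matrix : ℕ → Set
Matrix n = Fin n → Fin n → ℤ

_ᵀ : ∀ {n} → Matrix n → Matrix n
(M ᵀ) i j = M j i

_⊗_ : ∀ {n} → Matrix n → Matrix n → Matrix n
(A ⊗ B) i j = ∑ (λ k → A i k ℤ.* B k j)

identity : ∀ {n} → Matrix n
identity i j = if ⌊ i ≟ j ⌋ then + 1 else + 0

_·_ : ∀ {n} → ℤ → Matrix n → Matrix n
(c · M) i j = c ℤ.* M i j

bool→ℤ : Bool → ℤ
bool→ℤ true  = + 1
bool→ℤ false = + 0

degree : (G : Graph) → Fin (order G) → ℤ
degree G u = ∑ (λ v → bool→ℤ (adj G u v))

laplacian : (G : Graph) → Matrix (order G)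
laplacian G u v =
  if ⌊ u ≟ v ⌋ then degree G u else - bool→ℤ (adj G u v)

IsHadamard : (n : ℕ) → Matrix n → Set
IsHadamard n H =
  (∀ i j → (H i j ≡ + 1) ⊎ (H i j ≡ - (+ 1))) ×
  (∀ i j → ((H ᵀ) ⊗ H) i j ≡ ((+ n) · identity) i j)

-- (1/n) Hᵀ L H is diagonal  ⇔  all off-diagonal entries of Hᵀ L H vanish
-- (n ≥ 1 whenever the Hadamard matrix is relevant; for n = 0 both sides
-- are vacuous).  Division by the nonzero scalar n does not affect which
-- entries are zero.
IsDiagonal : ∀ {n} → Matrix n → Set
IsDiagonal M = ∀ i j → i ≢ j → M i j ≡ + 0

HadamardDiagonalizable : Graph → Set
HadamardDiagonalizable G =
  Σ' (Matrix (order G)) λ H →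
    IsHadamard (order G) H × IsDiagonal (((H ᵀ) ⊗ laplacian G) ⊗ H)
  where
  open import Data.Product renaming (Σ to Σ')

private
  eqᵇ : ∀ {n} → Fin n → Fin n → Bool
  eqᵇ i j = ⌊ i ≟ j ⌋

  eqᵇ-sym : ∀ {n} (i j : Fin n) → eqᵇ i j ≡ eqᵇ j i
  eqᵇ-sym i j with i ≟ j | j ≟ i
  ... | Relation.Nullary.yes _ | Relation.Nullary.yes _ = refl
  ... | Relation.Nullary.no _  | Relation.Nullary.no _  = refl
  ... | Relation.Nullary.yes p | Relation.Nullary.no q  = ⊥-elim (q (sym p))
  ... | Relation.Nullary.no p  | Relation.Nullary.yes q = ⊥-elim (p (sym q))

  eqᵇ-refl : ∀ {n} (i : Fin n) → eqᵇ i i ≡ true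
  eqᵇ-refl i with i ≟ i
  ... | Relation.Nullary.yes _ = refl
  ... | Relation.Nullary.no ¬p = ⊥-elim (¬p refl)

complete : ℕ → Graph
complete n = record
  { order = n
  ; adj = λ u v → not (eqᵇ u v)
  ; adj-sym = λ u v → cong not (eqᵇ-sym u v)
  ; adj-irr = λ u → cong not (eqᵇ-refl u)
  }

-- Cartesian product G □ H; vertex (u , x) of V(G) × V(H) is encoded as
-- the element of Fin (|G| * |H|) given by Data.Fin.combine u x
-- (decoded by remQuot).
_□_ : Graph → Graph → Graph
G □ H = record
  { order = order G ℕ.* order H
  ; adj = a
  ; adj-sym = λ p q → sym′ (remQuot (order H) p) (remQuot (order H) q)
  ; adj-irr = λ p → irr′ (remQuot (order H) p)
  }
  where
  a′ : Fin (order G) × Fin (order H) → Fin (order G) × Fin (order H) → Bool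
  a′ (u , x) (v , y) = (eqᵇ u v ∧ adj H x y) ∨ (eqᵇ x y ∧ adj G u v)
  a : Fin (order G ℕ.* order H) → Fin (order G ℕ.* order H) → Bool
  a p q = a′ (remQuot (order H) p) (remQuot (order H) q)
  sym′ : ∀ s t → a′ s t ≡ a′ t s
  sym′ (u , x) (v , y) rewrite eqᵇ-sym u v | eqᵇ-sym x y
                             | adj-sym G u v | adj-sym H x y = refl
  irr′ : ∀ s → a′ s s ≡ false
  irr′ (u , x) rewrite eqᵇ-refl u | eqᵇ-refl x
                     | adj-irr G u | adj-irr H x = refl

K₁ : Graph
K₁ = complete 1

_^□_ : Graph → ℕ → Graph
G ^□ zero  = K₁
G ^□ suc d = G □ (G ^□ d)

hamming4 : ℕ → Graph
hamming4 d = complete 4 ^□ d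

-- Shrikhande graph: Cayley graph on ℤ₄² with connection set
-- {±(0,1), ±(1,0), ±(1,1)}.  A vertex i : Fin 16 stands for the pair
-- remQuot 4 i : Fin 4 × Fin 4, read as an element of ℤ₄².
private
  sub4 : Fin 4 → Fin 4 → ℕ
  sub4 a b = (toℕ a ℕ.+ 4 ℕ.∸ toℕ b) % 4

  inConn : ℕ → ℕ → Bool
  inConn 0 1 = true
  inConn 0 3 = true
  inConn 1 0 = true
  inConn 3 0 = true
  inConn 1 1 = true
  inConn 3 3 = true
  inConn _ _ = false

  shrAdj′ : Fin 4 × Fin 4 → Fin 4 × Fin 4 → Bool
  shrAdj′ (a , b) (c , d) = inConn (sub4 a c) (sub4 b d)

  shrSym : ∀ s t → shrAdj′ s t ≡ shrAdj′ t s
  shrSym (a , b) (c , d) = lemma a c b d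
    where
    open import Data.Fin.Patterns
    lemma : ∀ a c b d → inConn (sub4 a c) (sub4 b d) ≡ inConn (sub4 c a) (sub4 d b)
    lemma 0F 0F 0F 0F = refl
    lemma 0F 0F 0F 1F = refl
    lemma 0F 0F 0F 2F = refl
    lemma 0F 0F 0F 3F = refl
    lemma 0F 0F 1F 0F = refl
    lemma 0F 0F 1F 1F = refl
    lemma 0F 0F 1F 2F = refl
    lemma 0F 0F 1F 3F = refl
    lemma 0F 0F 2F 0F = refl
    lemma 0F 0F 2F 1F = refl
    lemma 0F 0F 2F 2F = refl
    lemma 0F 0F 2F 3F = refl
    lemma 0F 0F 3F 0F = refl
    lemma 0F 0F 3F 1F = refl
    lemma 0F 0F 3F 2F = refl
    lemma 0F 0F 3F 3F = refl
    lemma 0F 1F 0F 0F = refl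
    lemma 0F 1F 0F 1F = refl
    lemma 0F 1F 0F 2F = refl
    lemma 0F 1F 0F 3F = refl
    lemma 0F 1F 1F 0F = refl
    lemma 0F 1F 1F 1F = refl
    lemma 0F 1F 1F 2F = refl
    lemma 0F 1F 1F 3F = refl
    lemma 0F 1F 2F 0F = refl
    lemma 0F 1F 2F 1F = refl
    lemma 0F 1F 2F 2F = refl
    lemma 0F 1F 2F 3F = refl
    lemma 0F 1F 3F 0F = refl
    lemma 0F 1F 3F 1F = refl
    lemma 0F 1F 3F 2F = refl
    lemma 0F 1F 3F 3F = refl
    lemma 0F 2F 0F 0F = refl
    lemma 0F 2F 0F 1F = refl
    lemma 0F 2F 0F 2F = refl
    lemma 0F 2F 0F 3F = refl
    lemma 0F 2F 1F 0F = refl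
    lemma 0F 2F 1F 1F = refl
    lemma 0F 2F 1F 2F = refl
    lemma 0F 2F 1F 3F = refl
    lemma 0F 2F 2F 0F = refl
    lemma 0F 2F 2F 1F = refl
    lemma 0F 2F 2F 2F = refl
    lemma 0F 2F 2F 3F = refl
    lemma 0F 2F 3F 0F = refl
    lemma 0F 2F 3F 1F = refl
    lemma 0F 2F 3F 2F = refl
    lemma 0F 2F 3F 3F = refl
    lemma 0F 3F 0F 0F = refl
    lemma 0F 3F 0F 1F = refl
    lemma 0F 3F 0F 2F = refl
    lemma 0F 3F 0F 3F = refl
    lemma 0F 3F 1F 0F = refl
    lemma 0F 3F 1F 1F = refl
    lemma 0F 3F 1F 2F = refl
    lemma 0F 3F 1F 3F = refl
    lemma 0F 3F 2F 0F = refl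
    lemma 0F 3F 2F 1F = refl
    lemma 0F 3F 2F 2F = refl
    lemma 0F 3F 2F 3F = refl
    lemma 0F 3F 3F 0F = refl
    lemma 0F 3F 3F 1F = refl
    lemma 0F 3F 3F 2F = refl
    lemma 0F 3F 3F 3F = refl
    lemma 1F 0F 0F 0F = refl
    lemma 1F 0F 0F 1F = refl
    lemma 1F 0F 0F 2F = refl
    lemma 1F 0F 0F 3F = refl
    lemma 1F 0F 1F 0F = refl
    lemma 1F 0F 1F 1F = refl
    lemma 1F 0F 1F 2F = refl
    lemma 1F 0F 1F 3F = refl
    lemma 1F 0F 2F 0F = refl
    lemma 1F 0F 2F 1F = refl
    lemma 1F 0F 2F 2F = refl
    lemma 1F 0F 2F 3F = refl
    lemma 1F 0F 3F 0F = refl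
    lemma 1F 0F 3F 1F = refl
    lemma 1F 0F 3F 2F = refl
    lemma 1F 0F 3F 3F = refl
    lemma 1F 1F 0F 0F = refl
    lemma 1F 1F 0F 1F = refl
    lemma 1F 1F 0F 2F = refl
    lemma 1F 1F 0F 3F = refl
    lemma 1F 1F 1F 0F = refl
    lemma 1F 1F 1F 1F = refl
    lemma 1F 1F 1F 2F = refl
    lemma 1F 1F 1F 3F = refl
    lemma 1F 1F 2F 0F = refl
    lemma 1F 1F 2F 1F = refl
    lemma 1F 1F 2F 2F = refl
    lemma 1F 1F 2F 3F = refl
    lemma 1F 1F 3F 0F = refl
    lemma 1F 1F 3F 1F = refl
    lemma 1F 1F 3F 2F = refl
    lemma 1F 1F 3F 3F = refl
    lemma 1F 2F 0F 0F = refl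
    lemma 1F 2F 0F 1F = refl
    lemma 1F 2F 0F 2F = refl
    lemma 1F 2F 0F 3F = refl
    lemma 1F 2F 1F 0F = refl
    lemma 1F 2F 1F 1F = refl
    lemma 1F 2F 1F 2F = refl
    lemma 1F 2F 1F 3F = refl
    lemma 1F 2F 2F 0F = refl
    lemma 1F 2F 2F 1F = refl
    lemma 1F 2F 2F 2F = refl
    lemma 1F 2F 2F 3F = refl
    lemma 1F 2F 3F 0F = refl
    lemma 1F 2F 3F 1F = refl
    lemma 1F 2F 3F 2F = refl
    lemma 1F 2F 3F 3F = refl
    lemma 1F 3F 0F 0F = refl
    lemma 1F 3F 0F 1F = refl
    lemma 1F 3F 0F 2F = refl
    lemma 1F 3F 0F 3F = refl
    lemma 1F 3F 1F 0F = refl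
    lemma 1F 3F 1F 1F = refl
    lemma 1F 3F 1F 2F = refl
    lemma 1F 3F 1F 3F = refl
    lemma 1F 3F 2F 0F = refl
    lemma 1F 3F 2F 1F = refl
    lemma 1F 3F 2F 2F = refl
    lemma 1F 3F 2F 3F = refl
    lemma 1F 3F 3F 0F = refl
    lemma 1F 3F 3F 1F = refl
    lemma 1F 3F 3F 2F = refl
    lemma 1F 3F 3F 3F = refl
    lemma 2F 0F 0F 0F = refl
    lemma 2F 0F 0F 1F = refl
    lemma 2F 0F 0F 2F = refl
    lemma 2F 0F 0F 3F = refl
    lemma 2F 0F 1F 0F = refl
    lemma 2F 0F 1F 1F = refl
    lemma 2F 0F 1F 2F = refl
    lemma 2F 0F 1F 3F = refl
    lemma 2F 0F 2F 0F = refl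
    lemma 2F 0F 2F 1F = refl
    lemma 2F 0F 2F 2F = refl
    lemma 2F 0F 2F 3F = refl
    lemma 2F 0F 3F 0F = refl
    lemma 2F 0F 3F 1F = refl
    lemma 2F 0F 3F 2F = refl
    lemma 2F 0F 3F 3F = refl
    lemma 2F 1F 0F 0F = refl
    lemma 2F 1F 0F 1F = refl
    lemma 2F 1F 0F 2F = refl
    lemma 2F 1F 0F 3F = refl
    lemma 2F 1F 1F 0F = refl
    lemma 2F 1F 1F 1F = refl
    lemma 2F 1F 1F 2F = refl
    lemma 2F 1F 1F 3F = refl
    lemma 2F 1F 2F 0F = refl
    lemma 2F 1F 2F 1F = refl
    lemma 2F 1F 2F 2F = refl
    lemma 2F 1F 2F 3F = refl
    lemma 2F 1F 3F 0F = refl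
    lemma 2F 1F 3F 1F = refl
    lemma 2F 1F 3F 2F = refl
    lemma 2F 1F 3F 3F = refl
    lemma 2F 2F 0F 0F = refl
    lemma 2F 2F 0F 1F = refl
    lemma 2F 2F 0F 2F = refl
    lemma 2F 2F 0F 3F = refl
    lemma 2F 2F 1F 0F = refl
    lemma 2F 2F 1F 1F = refl
    lemma 2F 2F 1F 2F = refl
    lemma 2F 2F 1F 3F = refl
    lemma 2F 2F 2F 0F = refl
    lemma 2F 2F 2F 1F = refl
    lemma 2F 2F 2F 2F = refl
    lemma 2F 2F 2F 3F = refl
    lemma 2F 2F 3F 0F = refl
    lemma 2F 2F 3F 1F = refl
    lemma 2F 2F 3F 2F = refl
    lemma 2F 2F 3F 3F = refl
    lemma 2F 3F 0F 0F = refl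
    lemma 2F 3F 0F 1F = refl
    lemma 2F 3F 0F 2F = refl
    lemma 2F 3F 0F 3F = refl
    lemma 2F 3F 1F 0F = refl
    lemma 2F 3F 1F 1F = refl
    lemma 2F 3F 1F 2F = refl
    lemma 2F 3F 1F 3F = refl
    lemma 2F 3F 2F 0F = refl
    lemma 2F 3F 2F 1F = refl
    lemma 2F 3F 2F 2F = refl
    lemma 2F 3F 2F 3F = refl
    lemma 2F 3F 3F 0F = refl
    lemma 2F 3F 3F 1F = refl
    lemma 2F 3F 3F 2F = refl
    lemma 2F 3F 3F 3F = refl
    lemma 3F 0F 0F 0F = refl
    lemma 3F 0F 0F 1F = refl
    lemma 3F 0F 0F 2F = refl
    lemma 3F 0F 0F 3F = refl
    lemma 3F 0F 1F 0F = refl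
    lemma 3F 0F 1F 1F = refl
    lemma 3F 0F 1F 2F = refl
    lemma 3F 0F 1F 3F = refl
    lemma 3F 0F 2F 0F = refl
    lemma 3F 0F 2F 1F = refl
    lemma 3F 0F 2F 2F = refl
    lemma 3F 0F 2F 3F = refl
    lemma 3F 0F 3F 0F = refl
    lemma 3F 0F 3F 1F = refl
    lemma 3F 0F 3F 2F = refl
    lemma 3F 0F 3F 3F = refl
    lemma 3F 1F 0F 0F = refl
    lemma 3F 1F 0F 1F = refl
    lemma 3F 1F 0F 2F = refl
    lemma 3F 1F 0F 3F = refl
    lemma 3F 1F 1F 0F = refl
    lemma 3F 1F 1F 1F = refl
    lemma 3F 1F 1F 2F = refl
    lemma 3F 1F 1F 3F = refl
    lemma 3F 1F 2F 0F = refl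
    lemma 3F 1F 2F 1F = refl
    lemma 3F 1F 2F 2F = refl
    lemma 3F 1F 2F 3F = refl
    lemma 3F 1F 3F 0F = refl
    lemma 3F 1F 3F 1F = refl
    lemma 3F 1F 3F 2F = refl
    lemma 3F 1F 3F 3F = refl
    lemma 3F 2F 0F 0F = refl
    lemma 3F 2F 0F 1F = refl
    lemma 3F 2F 0F 2F = refl
    lemma 3F 2F 0F 3F = refl
    lemma 3F 2F 1F 0F = refl
    lemma 3F 2F 1F 1F = refl
    lemma 3F 2F 1F 2F = refl
    lemma 3F 2F 1F 3F = refl
    lemma 3F 2F 2F 0F = refl
    lemma 3F 2F 2F 1F = refl
    lemma 3F 2F 2F 2F = refl
    lemma 3F 2F 2F 3F = refl
    lemma 3F 2F 3F 0F = refl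
    lemma 3F 2F 3F 1F = refl
    lemma 3F 2F 3F 2F = refl
    lemma 3F 2F 3F 3F = refl
    lemma 3F 3F 0F 0F = refl
    lemma 3F 3F 0F 1F = refl
    lemma 3F 3F 0F 2F = refl
    lemma 3F 3F 0F 3F = refl
    lemma 3F 3F 1F 0F = refl
    lemma 3F 3F 1F 1F = refl
    lemma 3F 3F 1F 2F = refl
    lemma 3F 3F 1F 3F = refl
    lemma 3F 3F 2F 0F = refl
    lemma 3F 3F 2F 1F = refl
    lemma 3F 3F 2F 2F = refl
    lemma 3F 3F 2F 3F = refl
    lemma 3F 3F 3F 0F = refl
    lemma 3F 3F 3F 1F = refl
    lemma 3F 3F 3F 2F = refl
    lemma 3F 3F 3F 3F = refl

  shrIrr : ∀ s → shrAdj′ s s ≡ false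
  shrIrr (a , b) = lemma a b
    where
    open import Data.Fin.Patterns
    lemma : ∀ a b → inConn (sub4 a a) (sub4 b b) ≡ false
    lemma 0F 0F = refl
    lemma 0F 1F = refl
    lemma 0F 2F = refl
    lemma 0F 3F = refl
    lemma 1F 0F = refl
    lemma 1F 1F = refl
    lemma 1F 2F = refl
    lemma 1F 3F = refl
    lemma 2F 0F = refl
    lemma 2F 1F = refl
    lemma 2F 2F = refl
    lemma 2F 3F = refl
    lemma 3F 0F = refl
    lemma 3F 1F = refl
    lemma 3F 2F = refl
    lemma 3F 3F = refl

shrikhande : Graph
shrikhande = record
  { order = 16
  ; adj = λ p q → shrAdj′ (remQuot 4 p) (remQuot 4 q)
  ; adj-sym = λ p q → shrSym (remQuot 4 p) (remQuot 4 q)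
  ; adj-irr = λ p → shrIrr (remQuot 4 p)
  }

doob : ℕ → ℕ → Graph
doob l d = (shrikhande ^□ l) □ hamming4 d

-- A Hadamard matrix H whose columns are eigenvectors of L diagonalises L, since
-- Hᵀ L H = Hᵀ H D = n D.  Such "Hadamard eigenbases" are closed under the Cartesian
-- product: the Laplacian of G □ H is L_G ⊠ I + I ⊠ L_H, so by the mixed-product rule
-- the Kronecker product of eigenbases of G and H is one of G □ H, with eigenvalues
-- adding up.  It therefore suffices to exhibit Hadamard eigenbases of K₁, K₄ and the
-- Shrikhande graph, which are checked by computation.
module Submission where

open import Defs
import Algebra.Properties.Semiring.Sum as SemiringSum
open import Data.Bool.Base using (true; false; _∧_; _∨_)
open import Data.Empty using (⊥-elim)
open import Data.Fin.Base using (Fin; zero; suc; combine; remQuot; quotient; remainder; _↑ˡ_; _↑ʳ_)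
open import Data.Fin.Properties using (_≟_; all?; remQuot-combine; combine-remQuot)
open import Data.Integer.Base using (ℤ; +_; -_; _+_; _*_; _◃_)
import Data.Integer.Properties as ℤ
open import Data.Integer.Tactic.RingSolver using (solve-∀)
open import Data.Nat.Base as ℕ using (ℕ; zero; suc; _≥_)
open import Data.Product.Base using (_×_; _,_; proj₂; uncurry)
open import Data.Sign.Base using (Sign) renaming (+ to ⁺; - to ⁻)
open import Data.Sum.Base using (_⊎_; inj₁; inj₂)
open import Data.Vec.Base using (Vec; []; _∷_; lookup)
open import Relation.Nullary.Decidable using (yes; no; True; ⌊_⌋; toWitness)
open import Relation.Binary.PropositionalEquality
open ≡-Reasoning

private
  variable
    m n : ℕ

module ∑ℤ = SemiringSum ℤ.+-*-semiring

∑≡sum : (f : Fin n → ℤ) → ∑ f ≡ ∑ℤ.sum f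
∑≡sum {zero}  f = refl
∑≡sum {suc n} f = cong (_+_ (f zero)) (∑≡sum (λ i → f (suc i)))

∑-cong : {f g : Fin n → ℤ} → (∀ i → f i ≡ g i) → ∑ f ≡ ∑ g
∑-cong {zero}  e = refl
∑-cong {suc n} e = cong₂ _+_ (e zero) (∑-cong (λ i → e (suc i)))

∑-distrib-+ : (f g : Fin n → ℤ) → ∑ (λ i → f i + g i) ≡ ∑ f + ∑ g
∑-distrib-+ f g
  rewrite ∑≡sum (λ i → f i + g i) | ∑≡sum f | ∑≡sum g = ∑ℤ.∑-distrib-+ f g

*-distribˡ-∑ : (c : ℤ) (f : Fin n → ℤ) → c * ∑ f ≡ ∑ (λ i → c * f i)
*-distribˡ-∑ c f rewrite ∑≡sum f | ∑≡sum (λ i → c * f i) = ∑ℤ.*-distribˡ-sum c f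

*-distribʳ-∑ : (c : ℤ) (f : Fin n → ℤ) → ∑ f * c ≡ ∑ (λ i → f i * c)
*-distribʳ-∑ c f rewrite ∑≡sum f | ∑≡sum (λ i → f i * c) = ∑ℤ.*-distribʳ-sum c f

∑-comm : (f : Fin m → Fin n → ℤ) → ∑ (λ i → ∑ (f i)) ≡ ∑ (λ j → ∑ (λ i → f i j))
∑-comm {m} {n} f = begin
  ∑ (λ i → ∑ (f i))                   ≡⟨ ∑-cong (λ i → ∑≡sum (f i)) ⟩
  ∑ (λ i → ∑ℤ.sum (f i))              ≡⟨ ∑≡sum (λ i → ∑ℤ.sum (f i)) ⟩
  ∑ℤ.sum (λ i → ∑ℤ.sum (f i))         ≡⟨ ∑ℤ.∑-comm f ⟩
  ∑ℤ.sum (λ j → ∑ℤ.sum (λ i → f i j)) ≡⟨ ∑≡sum (λ j → ∑ℤ.sum {m} (λ i → f i j)) ⟨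
  ∑ (λ j → ∑ℤ.sum (λ i → f i j))      ≡⟨ ∑-cong (λ j → ∑≡sum (λ i → f i j)) ⟨
  ∑ (λ j → ∑ (λ i → f i j))           ∎

∑-↑ : (f : Fin (m ℕ.+ n) → ℤ) → ∑ f ≡ ∑ (λ i → f (i ↑ˡ n)) + ∑ (λ j → f (m ↑ʳ j))
∑-↑ {zero}  f = sym (ℤ.+-identityˡ _)
∑-↑ {suc m} {n} f =
  trans (cong (_+_ (f zero)) (∑-↑ {m} {n} (λ i → f (suc i)))) (sym (ℤ.+-assoc (f zero) _ _))

∑-combine : (f : Fin (m ℕ.* n) → ℤ) → ∑ f ≡ ∑ (λ (i : Fin m) → ∑ (λ (j : Fin n) → f (combine i j)))
∑-combine {zero}      f = refl
∑-combine {suc m} {n} f =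
  trans (∑-↑ {n} {m ℕ.* n} f)
        (cong (_+_ (∑ (λ j → f (j ↑ˡ (m ℕ.* n))))) (∑-combine {m} {n} (λ i → f (n ↑ʳ i))))

∑-product : (f : Fin m → ℤ) (g : Fin n → ℤ) →
            ∑ (λ r → f (quotient n r) * g (remainder {m} n r)) ≡ ∑ f * ∑ g
∑-product {m} {n} f g = begin
  ∑ (λ r → f (quotient n r) * g (remainder {m} n r))      ≡⟨ ∑-combine {m} {n} _ ⟩
  ∑ (λ (i : Fin m) → ∑ (λ (j : Fin n) → f (quotient n (combine i j)) * g (remainder {m} n (combine i j))))
    ≡⟨ ∑-cong (λ i → ∑-cong (λ j → cong (uncurry λ i′ j′ → f i′ * g j′) (remQuot-combine i j))) ⟩
  ∑ (λ i → ∑ (λ j → f i * g j))                            ≡⟨ ∑-cong (λ i → *-distribˡ-∑ (f i) g) ⟨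
  ∑ (λ i → f i * ∑ g)                                      ≡⟨ *-distribʳ-∑ (∑ g) f ⟨
  ∑ f * ∑ g                                                ∎

identity-refl : (i : Fin n) → identity i i ≡ + 1
identity-refl i with i ≟ i
... | yes _   = refl
... | no i≢i = ⊥-elim (i≢i refl)

identity-≢ : {i j : Fin n} → i ≢ j → identity i j ≡ + 0
identity-≢ {i = i} {j} i≢j with i ≟ j
... | yes i≡j = ⊥-elim (i≢j i≡j)
... | no _    = refl

∑-identity : (i : Fin n) (f : Fin n → ℤ) → ∑ (λ j → identity i j * f j) ≡ f i
∑-identity {suc n} zero f = begin
  + 1 * f zero + ∑ (λ j → identity zero (suc j) * f (suc j))
    ≡⟨ cong₂ _+_ (ℤ.*-identityˡ (f zero))
                 (∑-cong λ j → cong (_* f (suc j)) (identity-≢ {i = zero} {suc j} λ ())) ⟩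
  f zero + ∑ (λ j → + 0 * f (suc j))                  ≡⟨ cong (_+_ (f zero)) (∑-cong λ j → ℤ.*-zeroˡ (f (suc j))) ⟩
  f zero + ∑ {n} (λ _ → + 0)
    ≡⟨ cong (_+_ (f zero)) (trans (∑≡sum {n} (λ _ → + 0)) (∑ℤ.sum-replicate-zero n)) ⟩
  f zero + + 0                                        ≡⟨ ℤ.+-identityʳ (f zero) ⟩
  f zero                                              ∎
∑-identity {suc n} (suc i) f = begin
  identity (suc i) zero * f zero + ∑ (λ j → identity (suc i) (suc j) * f (suc j))
    ≡⟨ cong₂ _+_ (cong (_* f zero) (identity-≢ {i = suc i} {zero} λ ()))
                 (∑-cong λ j → cong (_* f (suc j)) (identity-suc j)) ⟩
  + 0 * f zero + ∑ (λ j → identity i j * f (suc j))   ≡⟨ ℤ.+-identityˡ _ ⟩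
  ∑ (λ j → identity i j * f (suc j))                  ≡⟨ ∑-identity i (λ j → f (suc j)) ⟩
  f (suc i)                                           ∎
  where
  identity-suc : ∀ j → identity (suc i) (suc j) ≡ identity i j
  identity-suc j with i ≟ j
  ... | yes _ = refl
  ... | no _  = refl

∑-identity-row : (i : Fin n) → ∑ (identity i) ≡ + 1
∑-identity-row i = trans (∑-cong λ j → sym (ℤ.*-identityʳ (identity i j))) (∑-identity i (λ _ → + 1))

infix  4 _≋_
infixl 6 _+ᴹ_
infixl 7 _⊠_ _⊞_

_≋_ : Matrix n → Matrix n → Set
A ≋ B = ∀ i j → A i j ≡ B i j

_+ᴹ_ : Matrix n → Matrix n → Matrix n
(A +ᴹ B) i j = A i j + B i j

_⊠_ : Matrix m → Matrix n → Matrix (m ℕ.* n)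
_⊠_ {m} {n} A B p q = A (quotient n p) (quotient n q) * B (remainder {m} n p) (remainder {m} n q)

_⊞_ : (Fin m → ℤ) → (Fin n → ℤ) → Fin (m ℕ.* n) → ℤ
_⊞_ {m} {n} μ ν q = μ (quotient n q) + ν (remainder {m} n q)

⊗-congˡ : {A B : Matrix n} (C : Matrix n) → A ≋ B → A ⊗ C ≋ B ⊗ C
⊗-congˡ C A≋B i j = ∑-cong λ k → cong (_* C k j) (A≋B i k)

⊗-distribʳ-+ᴹ : (A B C : Matrix n) → (A +ᴹ B) ⊗ C ≋ A ⊗ C +ᴹ B ⊗ C
⊗-distribʳ-+ᴹ A B C i j =
  trans (∑-cong λ k → ℤ.*-distribʳ-+ (C k j) (A i k) (B i k))
        (∑-distrib-+ (λ k → A i k * C k j) (λ k → B i k * C k j))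

⊗-assoc : (A B C : Matrix n) → (A ⊗ B) ⊗ C ≋ A ⊗ (B ⊗ C)
⊗-assoc A B C i j = begin
  ∑ (λ k → ∑ (λ l → A i l * B l k) * C k j)  ≡⟨ ∑-cong (λ k → *-distribʳ-∑ (C k j) (λ l → A i l * B l k)) ⟩
  ∑ (λ k → ∑ (λ l → A i l * B l k * C k j))  ≡⟨ ∑-comm (λ k l → A i l * B l k * C k j) ⟩
  ∑ (λ l → ∑ (λ k → A i l * B l k * C k j))  ≡⟨ ∑-cong (λ l → ∑-cong λ k → ℤ.*-assoc (A i l) (B l k) (C k j)) ⟩
  ∑ (λ l → ∑ (λ k → A i l * (B l k * C k j))) ≡⟨ ∑-cong (λ l → *-distribˡ-∑ (A i l) (λ k → B l k * C k j)) ⟨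
  ∑ (λ l → A i l * ∑ (λ k → B l k * C k j))  ∎

⊗-identityˡ : (A : Matrix n) → identity ⊗ A ≋ A
⊗-identityˡ A i j = ∑-identity i (λ k → A k j)

⊠-⊗-⊠ : (A C : Matrix m) (B D : Matrix n) → (A ⊠ B) ⊗ (C ⊠ D) ≋ (A ⊗ C) ⊠ (B ⊗ D)
⊠-⊗-⊠ {m} {n} A C B D p q =
  trans (∑-cong λ r → interchange (A u (quotient n r)) (B x (remainder {m} n r))
                                  (C (quotient n r) v) (D (remainder {m} n r) y))
        (∑-product (λ k → A u k * C k v) (λ l → B x l * D l y))
  where
  u = quotient n p; v = quotient n q; x = remainder {m} n p; y = remainder {m} n q
  interchange : ∀ a b c d → a * b * (c * d) ≡ a * c * (b * d)
  interchange = solve-∀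

remQuot-injective : {p q : Fin (m ℕ.* n)} → remQuot {m} n p ≡ remQuot n q → p ≡ q
remQuot-injective {m} {n} {p} {q} e = begin
  p                                   ≡⟨ combine-remQuot {m} n p ⟨
  uncurry combine (remQuot {m} n p)   ≡⟨ cong (uncurry combine) e ⟩
  uncurry combine (remQuot {m} n q)   ≡⟨ combine-remQuot {m} n q ⟩
  q                                   ∎

identity-×-≢ : {u v : Fin m} {x y : Fin n} → (u , x) ≢ (v , y) → identity u v * identity x y ≡ + 0
identity-×-≢ {u = u} {v} {x} {y} ne with u ≟ v | x ≟ y
... | yes refl | yes refl = ⊥-elim (ne refl)
... | yes refl | no _     = refl
... | no _     | _        = refl

identity-⊠ : identity {m} ⊠ identity {n} ≋ identity
identity-⊠ {m} {n} p q with p ≟ q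
... | yes refl = cong₂ _*_ (identity-refl (quotient {m} n p)) (identity-refl (remainder {m} n p))
... | no p≢q  = identity-×-≢ {u = quotient {m} n p} {quotient {m} n q} {remainder {m} n p} {remainder {m} n q}
                   (λ e → p≢q (remQuot-injective {m} {n} e))

adjacency : (G : Graph) → Matrix (order G)
adjacency G u v = bool→ℤ (adj G u v)

laplacian-degree : (G : Graph) (u v : Fin (order G)) →
                   laplacian G u v ≡ identity u v * degree G u + - adjacency G u v
laplacian-degree G u v with u ≟ v
... | yes refl rewrite adj-irr G u = sym (trans (ℤ.+-identityʳ _) (ℤ.*-identityˡ _))
... | no _     = sym (ℤ.+-identityˡ _)

module _ (G H : Graph) where

  private
    πG : Fin (order (G □ H)) → Fin (order G)
    πG = quotient (order H)
    πH : Fin (order (G □ H)) → Fin (order H)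
    πH = remainder {order G} (order H)

  adjacency-□ : adjacency (G □ H) ≋ adjacency G ⊠ identity +ᴹ identity {order G} ⊠ adjacency H
  adjacency-□ p q = coordinates (πG p) (πG q) (πH p) (πH q)
    where
    coordinates : ∀ u v x y →
      bool→ℤ ((⌊ u ≟ v ⌋ ∧ adj H x y) ∨ (⌊ x ≟ y ⌋ ∧ adj G u v))
        ≡ adjacency G u v * identity x y + identity u v * adjacency H x y
    coordinates u v x y with u ≟ v | x ≟ y
    ... | yes refl | yes refl rewrite adj-irr G u | adj-irr H x = refl
    ... | yes refl | no _     rewrite adj-irr G u with adj H x y
    ...   | true  = refl
    ...   | false = refl
    coordinates u v x y | no _ | yes refl with adj G u v
    ...   | true  = refl
    ...   | false = refl
    coordinates u v x y | no _ | no _ with adj G u v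
    ...   | true  = refl
    ...   | false = refl

  degree-□ : (p : Fin (order (G □ H))) → degree (G □ H) p ≡ degree G (πG p) + degree H (πH p)
  degree-□ p = begin
    ∑ (adjacency (G □ H) p)
      ≡⟨ ∑-cong (adjacency-□ p) ⟩
    ∑ (λ q → (adjacency G ⊠ identity) p q + (identity {order G} ⊠ adjacency H) p q)
      ≡⟨ ∑-distrib-+ ((adjacency G ⊠ identity) p) ((identity {order G} ⊠ adjacency H) p) ⟩
    ∑ ((adjacency G ⊠ identity) p) + ∑ ((identity {order G} ⊠ adjacency H) p)
      ≡⟨ cong₂ _+_ (∑-product (adjacency G u) (identity x)) (∑-product (identity u) (adjacency H x)) ⟩
    degree G u * ∑ (identity x) + ∑ (identity u) * degree H x
      ≡⟨ cong₂ _+_ (cong (degree G u *_) (∑-identity-row x)) (cong (_* degree H x) (∑-identity-row u)) ⟩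
    degree G u * + 1 + + 1 * degree H x
      ≡⟨ cong₂ _+_ (ℤ.*-identityʳ (degree G u)) (ℤ.*-identityˡ (degree H x)) ⟩
    degree G u + degree H x
      ∎
    where
    u = πG p
    x = πH p

  laplacian-□ : laplacian (G □ H) ≋ laplacian G ⊠ identity +ᴹ identity {order G} ⊠ laplacian H
  laplacian-□ p q = begin
    laplacian (G □ H) p q
      ≡⟨ laplacian-degree (G □ H) p q ⟩
    identity p q * degree (G □ H) p + - adjacency (G □ H) p q
      ≡⟨ cong₂ _+_ (cong₂ _*_ (sym (identity-⊠ {order G} p q)) (degree-□ p)) (cong -_ (adjacency-□ p q)) ⟩
    δG * δH * (degree G u + degree H x) + - (adjacency G u v * δH + δG * adjacency H x y)
      ≡⟨ regroup δG δH (degree G u) (degree H x) (adjacency G u v) (adjacency H x y) ⟩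
    (δG * degree G u + - adjacency G u v) * δH + δG * (δH * degree H x + - adjacency H x y)
      ≡⟨ cong₂ (λ a b → a * δH + δG * b) (laplacian-degree G u v) (laplacian-degree H x y) ⟨
    laplacian G u v * δH + δG * laplacian H x y
      ∎
    where
    u = πG p; v = πG q; x = πH p; y = πH q
    δG = identity u v
    δH = identity x y
    regroup : ∀ a b c d e f → a * b * (c + d) + - (e * b + a * f) ≡ (a * c + - e) * b + a * (b * d + - f)
    regroup = solve-∀

IsUnit : ℤ → Set
IsUnit a = (a ≡ + 1) ⊎ (a ≡ - (+ 1))

isUnit-* : {a b : ℤ} → IsUnit a → IsUnit b → IsUnit (a * b)
isUnit-* (inj₁ refl) (inj₁ refl) = inj₁ refl
isUnit-* (inj₁ refl) (inj₂ refl) = inj₂ refl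
isUnit-* (inj₂ refl) (inj₁ refl) = inj₂ refl
isUnit-* (inj₂ refl) (inj₂ refl) = inj₁ refl

isUnit-◃1 : (s : Sign) → IsUnit (s ◃ 1)
isUnit-◃1 ⁺ = inj₁ refl
isUnit-◃1 ⁻ = inj₂ refl

isHadamard-⊠ : {A : Matrix m} {B : Matrix n} →
               IsHadamard m A → IsHadamard n B → IsHadamard (m ℕ.* n) (A ⊠ B)
isHadamard-⊠ {m} {n} {A} {B} (unitsA , orthA) (unitsB , orthB) = units , orth
  where
  units : ∀ p q → IsUnit ((A ⊠ B) p q)
  units p q = isUnit-* (unitsA _ _) (unitsB _ _)
  orth : ∀ p q → (((A ⊠ B) ᵀ) ⊗ (A ⊠ B)) p q ≡ ((+ (m ℕ.* n)) · identity) p q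
  orth p q = begin
    (((A ⊠ B) ᵀ) ⊗ (A ⊠ B)) p q                ≡⟨ ⊠-⊗-⊠ (A ᵀ) A (B ᵀ) B p q ⟩
    ((A ᵀ) ⊗ A) u v * ((B ᵀ) ⊗ B) x y          ≡⟨ cong₂ _*_ (orthA u v) (orthB x y) ⟩
    + m * identity u v * (+ n * identity x y)  ≡⟨ interchange (+ m) (identity u v) (+ n) (identity x y) ⟩
    + m * + n * (identity u v * identity x y)  ≡⟨ cong₂ _*_ (ℤ.pos-* m n) (sym (identity-⊠ {m} {n} p q)) ⟨
    + (m ℕ.* n) * identity p q                 ∎
    where
    u = quotient {m} n p; v = quotient {m} n q; x = remainder {m} n p; y = remainder {m} n q
    interchange : ∀ a b c d → a * b * (c * d) ≡ a * c * (b * d)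
    interchange = solve-∀

record HadamardEigenbasis (G : Graph) : Set where
  field
    matrix      : Matrix (order G)
    eigenvalue  : Fin (order G) → ℤ
    isHadamard  : IsHadamard (order G) matrix
    eigenvector : laplacian G ⊗ matrix ≋ λ i j → eigenvalue j * matrix i j

eigenbasis⇒diagonalizable : {G : Graph} → HadamardEigenbasis G → HadamardDiagonalizable G
eigenbasis⇒diagonalizable {G} E = H , isHadamard , offDiagonal
  where
  open HadamardEigenbasis E renaming (matrix to H; eigenvalue to μ)
  offDiagonal : IsDiagonal (((H ᵀ) ⊗ laplacian G) ⊗ H)
  offDiagonal i j i≢j = begin
    (((H ᵀ) ⊗ laplacian G) ⊗ H) i j             ≡⟨ ⊗-assoc (H ᵀ) (laplacian G) H i j ⟩
    ∑ (λ k → H k i * (laplacian G ⊗ H) k j)    ≡⟨ ∑-cong (λ k → cong (H k i *_) (eigenvector k j)) ⟩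
    ∑ (λ k → H k i * (μ j * H k j))            ≡⟨ ∑-cong (λ k → exchange (H k i) (μ j) (H k j)) ⟩
    ∑ (λ k → μ j * (H k i * H k j))            ≡⟨ *-distribˡ-∑ (μ j) (λ k → H k i * H k j) ⟨
    μ j * ((H ᵀ) ⊗ H) i j                      ≡⟨ cong (μ j *_) (proj₂ isHadamard i j) ⟩
    μ j * (+ order G * identity i j)           ≡⟨ cong (λ δ → μ j * (+ order G * δ)) (identity-≢ i≢j) ⟩
    μ j * (+ order G * + 0)                    ≡⟨ cong (μ j *_) (ℤ.*-zeroʳ (+ order G)) ⟩
    μ j * + 0                                  ≡⟨ ℤ.*-zeroʳ (μ j) ⟩
    + 0                                        ∎
    where
    exchange : ∀ a b c → a * (b * c) ≡ b * (a * c)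
    exchange = solve-∀

eigenbasis-□ : {G H : Graph} → HadamardEigenbasis G → HadamardEigenbasis H → HadamardEigenbasis (G □ H)
eigenbasis-□ {G} {H} E F = record
  { matrix      = A ⊠ B
  ; eigenvalue  = μ ⊞ ν
  ; isHadamard  = isHadamard-⊠ (HadamardEigenbasis.isHadamard E) (HadamardEigenbasis.isHadamard F)
  ; eigenvector = eigenvector
  }
  where
  open HadamardEigenbasis E using () renaming (matrix to A; eigenvalue to μ; eigenvector to eigenA)
  open HadamardEigenbasis F using () renaming (matrix to B; eigenvalue to ν; eigenvector to eigenB)
  LG = laplacian G
  LH = laplacian H
  IG = identity {order G}
  IH = identity {order H}
  eigenvector : laplacian (G □ H) ⊗ (A ⊠ B) ≋ λ p q → (μ ⊞ ν) q * (A ⊠ B) p q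
  eigenvector p q = begin
    (laplacian (G □ H) ⊗ (A ⊠ B)) p q
      ≡⟨ ⊗-congˡ (A ⊠ B) (laplacian-□ G H) p q ⟩
    ((LG ⊠ IH +ᴹ IG ⊠ LH) ⊗ (A ⊠ B)) p q
      ≡⟨ ⊗-distribʳ-+ᴹ (LG ⊠ IH) (IG ⊠ LH) (A ⊠ B) p q ⟩
    ((LG ⊠ IH) ⊗ (A ⊠ B)) p q + ((IG ⊠ LH) ⊗ (A ⊠ B)) p q
      ≡⟨ cong₂ _+_ (⊠-⊗-⊠ LG A IH B p q) (⊠-⊗-⊠ IG A LH B p q) ⟩
    (LG ⊗ A) u i * (IH ⊗ B) x j + (IG ⊗ A) u i * (LH ⊗ B) x j
      ≡⟨ cong₂ _+_ (cong₂ _*_ (eigenA u i) (⊗-identityˡ B x j))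
                   (cong₂ _*_ (⊗-identityˡ A u i) (eigenB x j)) ⟩
    μ i * A u i * B x j + A u i * (ν j * B x j)
      ≡⟨ collect (μ i) (ν j) (A u i) (B x j) ⟩
    (μ i + ν j) * (A u i * B x j)
      ∎
    where
    u = quotient {order G} (order H) p; i = quotient {order G} (order H) q
    x = remainder {order G} (order H) p; j = remainder {order G} (order H) q
    collect : ∀ a b c d → a * c * d + c * (b * d) ≡ (a + b) * (c * d)
    collect = solve-∀

signMatrix : Vec (Vec Sign n) n → Matrix n
signMatrix columns i j = lookup (lookup columns j) i ◃ 1

columnEigenbasis : (G : Graph) (columns : Vec (Vec Sign (order G)) (order G)) (μ : Vec ℤ (order G)) →
  let H = signMatrix columns in
  {True (all? λ i → all? λ j → ((H ᵀ) ⊗ H) i j ℤ.≟ ((+ order G) · identity) i j)} →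
  {True (all? λ i → all? λ j → (laplacian G ⊗ H) i j ℤ.≟ lookup μ j * H i j)} →
  HadamardEigenbasis G
columnEigenbasis G columns μ {orthogonal} {eigen} = record
  { matrix      = signMatrix columns
  ; eigenvalue  = lookup μ
  ; isHadamard  = (λ i j → isUnit-◃1 (lookup (lookup columns j) i)) , toWitness orthogonal
  ; eigenvector = toWitness eigen
  }

eigenbasis-K₁ : HadamardEigenbasis K₁
eigenbasis-K₁ = columnEigenbasis K₁ ((⁺ ∷ []) ∷ []) (+ 0 ∷ [])

eigenbasis-^□ : {G : Graph} → HadamardEigenbasis G → (d : ℕ) → HadamardEigenbasis (G ^□ d)
eigenbasis-^□ E zero    = eigenbasis-K₁
eigenbasis-^□ E (suc d) = eigenbasis-□ E (eigenbasis-^□ E d)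

eigenbasis-K₄ : HadamardEigenbasis (complete 4)
eigenbasis-K₄ = columnEigenbasis (complete 4)
  ( (⁺ ∷ ⁺ ∷ ⁺ ∷ ⁺ ∷ [])
  ∷ (⁺ ∷ ⁻ ∷ ⁺ ∷ ⁻ ∷ [])
  ∷ (⁺ ∷ ⁺ ∷ ⁻ ∷ ⁻ ∷ [])
  ∷ (⁺ ∷ ⁻ ∷ ⁻ ∷ ⁺ ∷ [])
  ∷ [])
  (+ 0 ∷ + 4 ∷ + 4 ∷ + 4 ∷ [])

eigenbasis-shrikhande : HadamardEigenbasis shrikhande
eigenbasis-shrikhande = columnEigenbasis shrikhande
  ( (⁺ ∷ ⁺ ∷ ⁺ ∷ ⁺ ∷ ⁺ ∷ ⁺ ∷ ⁺ ∷ ⁺ ∷ ⁺ ∷ ⁺ ∷ ⁺ ∷ ⁺ ∷ ⁺ ∷ ⁺ ∷ ⁺ ∷ ⁺ ∷ [])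
  ∷ (⁺ ∷ ⁺ ∷ ⁺ ∷ ⁺ ∷ ⁻ ∷ ⁻ ∷ ⁻ ∷ ⁻ ∷ ⁻ ∷ ⁻ ∷ ⁻ ∷ ⁻ ∷ ⁺ ∷ ⁺ ∷ ⁺ ∷ ⁺ ∷ [])
  ∷ (⁺ ∷ ⁻ ∷ ⁻ ∷ ⁻ ∷ ⁻ ∷ ⁺ ∷ ⁺ ∷ ⁺ ∷ ⁺ ∷ ⁻ ∷ ⁻ ∷ ⁻ ∷ ⁻ ∷ ⁺ ∷ ⁺ ∷ ⁺ ∷ [])
  ∷ (⁺ ∷ ⁻ ∷ ⁻ ∷ ⁺ ∷ ⁺ ∷ ⁺ ∷ ⁻ ∷ ⁻ ∷ ⁻ ∷ ⁺ ∷ ⁺ ∷ ⁻ ∷ ⁻ ∷ ⁻ ∷ ⁺ ∷ ⁺ ∷ [])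
  ∷ (⁺ ∷ ⁻ ∷ ⁺ ∷ ⁻ ∷ ⁺ ∷ ⁻ ∷ ⁺ ∷ ⁻ ∷ ⁻ ∷ ⁺ ∷ ⁻ ∷ ⁺ ∷ ⁻ ∷ ⁺ ∷ ⁻ ∷ ⁺ ∷ [])
  ∷ (⁺ ∷ ⁺ ∷ ⁻ ∷ ⁻ ∷ ⁻ ∷ ⁺ ∷ ⁺ ∷ ⁻ ∷ ⁻ ∷ ⁻ ∷ ⁺ ∷ ⁺ ∷ ⁺ ∷ ⁻ ∷ ⁻ ∷ ⁺ ∷ [])
  ∷ (⁺ ∷ ⁻ ∷ ⁻ ∷ ⁺ ∷ ⁺ ∷ ⁻ ∷ ⁻ ∷ ⁺ ∷ ⁺ ∷ ⁻ ∷ ⁻ ∷ ⁺ ∷ ⁺ ∷ ⁻ ∷ ⁻ ∷ ⁺ ∷ [])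
  ∷ (⁺ ∷ ⁺ ∷ ⁺ ∷ ⁻ ∷ ⁻ ∷ ⁻ ∷ ⁻ ∷ ⁺ ∷ ⁺ ∷ ⁺ ∷ ⁺ ∷ ⁻ ∷ ⁻ ∷ ⁻ ∷ ⁻ ∷ ⁺ ∷ [])
  ∷ (⁺ ∷ ⁺ ∷ ⁻ ∷ ⁻ ∷ ⁺ ∷ ⁻ ∷ ⁻ ∷ ⁺ ∷ ⁻ ∷ ⁻ ∷ ⁺ ∷ ⁺ ∷ ⁻ ∷ ⁺ ∷ ⁺ ∷ ⁻ ∷ [])
  ∷ (⁺ ∷ ⁻ ∷ ⁺ ∷ ⁻ ∷ ⁻ ∷ ⁺ ∷ ⁻ ∷ ⁺ ∷ ⁻ ∷ ⁺ ∷ ⁻ ∷ ⁺ ∷ ⁺ ∷ ⁻ ∷ ⁺ ∷ ⁻ ∷ [])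
  ∷ (⁺ ∷ ⁻ ∷ ⁺ ∷ ⁻ ∷ ⁺ ∷ ⁻ ∷ ⁺ ∷ ⁻ ∷ ⁺ ∷ ⁻ ∷ ⁺ ∷ ⁻ ∷ ⁺ ∷ ⁻ ∷ ⁺ ∷ ⁻ ∷ [])
  ∷ (⁺ ∷ ⁺ ∷ ⁻ ∷ ⁺ ∷ ⁻ ∷ ⁻ ∷ ⁺ ∷ ⁻ ∷ ⁺ ∷ ⁺ ∷ ⁻ ∷ ⁺ ∷ ⁻ ∷ ⁻ ∷ ⁺ ∷ ⁻ ∷ [])
  ∷ (⁺ ∷ ⁻ ∷ ⁻ ∷ ⁺ ∷ ⁻ ∷ ⁻ ∷ ⁺ ∷ ⁺ ∷ ⁻ ∷ ⁺ ∷ ⁺ ∷ ⁻ ∷ ⁺ ∷ ⁺ ∷ ⁻ ∷ ⁻ ∷ [])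
  ∷ (⁺ ∷ ⁺ ∷ ⁻ ∷ ⁻ ∷ ⁺ ∷ ⁺ ∷ ⁻ ∷ ⁻ ∷ ⁺ ∷ ⁺ ∷ ⁻ ∷ ⁻ ∷ ⁺ ∷ ⁺ ∷ ⁻ ∷ ⁻ ∷ [])
  ∷ (⁺ ∷ ⁻ ∷ ⁺ ∷ ⁺ ∷ ⁻ ∷ ⁺ ∷ ⁻ ∷ ⁻ ∷ ⁺ ∷ ⁻ ∷ ⁺ ∷ ⁺ ∷ ⁻ ∷ ⁺ ∷ ⁻ ∷ ⁻ ∷ [])
  ∷ (⁺ ∷ ⁺ ∷ ⁺ ∷ ⁺ ∷ ⁺ ∷ ⁺ ∷ ⁺ ∷ ⁺ ∷ ⁻ ∷ ⁻ ∷ ⁻ ∷ ⁻ ∷ ⁻ ∷ ⁻ ∷ ⁻ ∷ ⁻ ∷ [])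
  ∷ [])
  (+ 0 ∷ + 4 ∷ + 8 ∷ + 4 ∷ + 8 ∷ + 4 ∷ + 4 ∷ + 8 ∷ + 8 ∷ + 8 ∷ + 8 ∷ + 8 ∷ + 8 ∷ + 4 ∷ + 8 ∷ + 4 ∷ [])

mainTheorem6 : ((d : ℕ) → d ≥ 1 → HadamardDiagonalizable (hamming4 d))
               × ((l d : ℕ) → l ≥ 1 → d ≥ 1 → HadamardDiagonalizable (doob l d))
mainTheorem6 =
    (λ d _ → eigenbasis⇒diagonalizable (hamming d))
  , (λ l d _ _ → eigenbasis⇒diagonalizable
                   (eigenbasis-□ (eigenbasis-^□ eigenbasis-shrikhande l) (hamming d)))
  where
  hamming : (d : ℕ) → HadamardEigenbasis (hamming4 d)
  hamming = eigenbasis-^□ eigenbasis-K₄
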